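{- Let $\mathcal{S}=(X,\Sigma,\to,\preceq_p,x_0)$ be the OLTS associated with a FIFO machine, ordered by the extended prefix ordering. If the labelled reduced reachability tree $\mathrm{lRRT}(\mathcal{S},x_0)$ has at least one iterable node, then $\mathcal{S}$ is non-terminating, i.e. there is an infinite run from $x_0$.
   Context: A FIFO machine over finite channel set $\mathsf{Ch}$ is $\mathcal{M}=(Q,A,T,q_0)$ with finite control states $Q$, finite message alphabet $A$, $T\subseteq Q\times\mathsf{Ch}\times\{!,?\}\times A\times Q$. Its OLTS has states $X=Q\times(A^*)^{\mathsf{Ch}}$, action alphabet $\Sigma=\mathsf{Ch}\times\{!,?\}\times A$, initial state $x_0=(q_0,\varepsilon)$; $(q,\mathbf{w})\xrightarrow{c!a}(q',\mathbf{w}')$ if $(q,c!a,q')\in T$, $\mathbf{w}'_c=\mathbf{w}_ca$, other channels unchanged; $(q,\mathbf{w})\xrightarrow{c?a}(q',\mathbf{w}')$ if $(q,c?a,q')\in T$, $\mathbf{w}_c=a\mathbf{w}'_c$, other channels unchanged. Extended prefix ordering: $(q,\mathbf{w})\preceq_p(q',\mathbf{w}')$ iff $q=q'$ and $\mathbf{w}_c$ is a prefix of $\mathbf{w}'_c$ for all $c$. $\mathrm{Post}(x)=\{y\mid x\to y\}$. The reduced reachability tree $\mathrm{RRT}(\mathcal{S},x_0)$: root labelled $x_0$ with a child labelled $x$ for each $x\in\mathrm{Post}(x_0)$; repeatedly an unmarked vertex $n$ labelled $x$ is picked: if it has an ancestor $n'$ labelled $x'$ with $x'\preceq_p x$, $n$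 is marked dead and $n'$ subsumes $n$; otherwise $n$ is marked live and gets a child labelled $y$ for each $y\in\mathrm{Post}(x)$. The labelled RRT $\mathrm{lRRT}(\mathcal{S},x_0)$ additionally marks a dead vertex $n'$ labelled $x'$ as iterable if it is subsumed by a node $n$ labelled $x$ (so $x\preceq_p x'$) with $x\xrightarrow{\sigma}x'$ for some $\sigma\in\Sigma^*$, and there exists $x''\in X$ with $x'\xrightarrow{\sigma}x''$ and $x'\preceq_p x''$. -}

module Defs where

open import Data.Nat using (ℕ; zero; suc; _<_)
open import Data.Fin using (Fin)
open import Data.List using (List; []; _∷_; _++_; [_])
open import Data.List.Membership.Propositional using (_∈_)
open import Data.List.Relation.Binary.Prefix.Heterogeneous using (Prefix)
open import Data.Vec using (Vec; lookup; replicate; _[_]%=_; _[_]≔_)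
open import Data.Product using (Σ; ∃; _×_; _,_)
open import Relation.Binary.PropositionalEquality using (_≡_)
open import Relation.Nullary using (¬_)

data Dir : Set where
  `! `? : Dir

-- A FIFO machine with control states Q = Fin nQ, channels Ch = Fin nC,
-- message alphabet A = Fin nA; T is a finite set (list) of transitions
-- (q , c , d , a , q').
record FIFO (nQ nC nA : ℕ) : Set where
  field
    T  : List (Fin nQ × Fin nC × Dir × Fin nA × Fin nQ)
    q₀ : Fin nQ

module OLTS {nQ nC nA : ℕ} (M : FIFO nQ nC nA) where
  open FIFO M

  X : Set
  X = Fin nQ × Vec (List (Fin nA)) nC

  Act : Set
  Act = Fin nC × Dir × Fin nA

  x₀ : X
  x₀ = q₀ , replicate nC []

  data _⟶[_]_ : X → Act → X → Set where
    send : ∀ {q q' c a w} → (q , c , `! , a , q') ∈ T →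
           (q , w) ⟶[ (c , `! , a) ] (q' , (w [ c ]%= (λ u → u ++ [ a ])))
    recv : ∀ {q q' c a w u} → (q , c , `? , a , q') ∈ T →
           lookup w c ≡ a ∷ u →
           (q , w) ⟶[ (c , `? , a) ] (q' , (w [ c ]≔ u))

  _⟶_ : X → X → Set
  x ⟶ y = Σ Act λ σ → x ⟶[ σ ] y

  data _⟶*[_]_ : X → List Act → X → Set where
    done : ∀ {x} → x ⟶*[ [] ] x
    step : ∀ {x y z a σ} → x ⟶[ a ] y → y ⟶*[ σ ] z → x ⟶*[ a ∷ σ ] z

  _⪯p_ : X → X → Set
  (q , w) ⪯p (q' , w') = q ≡ q' × (∀ c → Prefix _≡_ (lookup w c) (lookup w' c))

  -- A vertex of RRT(S,x₀) at depth k is determined by the sequence of labels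
  -- p 0 , … , p k along the branch from the root (only indices ≤ k matter):
  -- p 0 = x₀, p (i+1) ∈ Post(p i), and every proper ancestor p i (i < k) is
  -- live, i.e. has no ancestor p j (j < i) with p j ⪯p p i.
  record RRTVertex : Set where
    field
      depth : ℕ
      label : ℕ → X
      root  : label 0 ≡ x₀
      edges : ∀ i → i < depth → label i ⟶ label (suc i)
      live-ancestors : ∀ i → i < depth → ∀ j → j < i → ¬ (label j ⪯p label i)

  Iterable : RRTVertex → Set
  Iterable v =
    ∃ λ j → j < depth × (label j ⪯p label depth) ×
      (∃ λ (σ : List Act) → (label j ⟶*[ σ ] label depth) ×
        (∃ λ (x'' : X) → (label depth ⟶*[ σ ] x'') × (label depth ⪯p x'')))
    where open RRTVertex v

  HasIterableNode : Set
  HasIterableNode = ∃ λ (v : RRTVertex) → Iterable v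

  NonTerminating : Set
  NonTerminating = ∃ λ (f : ℕ → X) → f 0 ≡ x₀ × (∀ i → f i ⟶ f (suc i))

-- Along a word σ each channel c behaves like w · S ≡ R · w′, where S and R are the
-- messages σ sends on and receives from c.  For x →σ x′ →σ x″ with x ⪯p x′ ⪯p x″,
-- write x′ = x · t and x″ = x′ · v channelwise: combinatorics on the two equations
-- forces v = t and x″ · S ≡ R · x″ · t.  So σ can be replayed from x″ (its queues are
-- at least as long as those of x′, and they hold the messages σ will receive),
-- ending in x″ · t ⪰p x″; the situation repeats forever, and the run from x₀ to the
-- subsuming ancestor followed by σ^ω is infinite.

module Submission where

open import Defs
open import Function using (_∘_)
open import Data.Nat using (ℕ; zero; suc; pred; _≤_; z≤n; s≤s; _<_; s≤s⁻¹; _≤‴_; ≤‴-refl; ≤‴-step)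
open import Data.Nat.Induction using (<-wellFounded)
open import Induction.WellFounded using (Acc; acc)
open import Data.Nat.Properties using (<⇒≤; ≤-refl; ≤-trans; +-monoˡ-≤; ≤⇒≤‴; ≤‴⇒≤)
open import Data.Fin using (Fin; _≟_)
open import Data.List using (List; []; _∷_; _++_; [_]; length)
open import Data.List.Properties
  using (++-assoc; ++-identityʳ; ++-cancelˡ; ∷-injective; length-++; length-++-comm; length-++-≤ʳ)
open import Data.List.Relation.Binary.Prefix.Heterogeneous using (Prefix)
open import Data.List.Relation.Binary.Prefix.Heterogeneous.Properties
  using (length-mono; fromPointwise)
open import Data.List.Relation.Binary.Prefix.Propositional.Properties
  using (Prefix-as-∣ˡ; ∣ˡ-as-Prefix)
open import Algebra.Definitions.RawMagma using (_,_)
import Data.List.Relation.Binary.Pointwise as Pointwise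
open import Data.Vec using (Vec; lookup; _[_]%=_; _[_]≔_)
open import Data.Vec.Properties using (lookup∘updateAt; lookup∘updateAt′)
open import Data.Product using (Σ; ∃; _×_; _,_; proj₁; proj₂; map₂)
open import Data.Sum using (_⊎_; inj₁; inj₂)
open import Data.Empty using (⊥-elim)
open import Relation.Binary.PropositionalEquality
  using (_≡_; _≢_; refl; sym; trans; cong; subst; subst₂; module ≡-Reasoning)
open import Relation.Nullary using (yes; no)

module _ {a} {A : Set a} where

  ++-split : ∀ (xs ys us vs : List A) → xs ++ ys ≡ us ++ vs →
             (∃ λ e → us ≡ xs ++ e × ys ≡ e ++ vs) ⊎ (∃ λ e → xs ≡ us ++ e × vs ≡ e ++ ys)
  ++-split []       ys us       vs eq = inj₁ (us , refl , eq)
  ++-split (x ∷ xs) ys []       vs eq = inj₂ (x ∷ xs , refl , sym eq)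
  ++-split (x ∷ xs) ys (u ∷ us) vs eq with ∷-injective eq
  ... | refl , eq′ with ++-split xs ys us vs eq′
  ...   | inj₁ (e , p , q) = inj₁ (e , cong (x ∷_) p , q)
  ...   | inj₂ (e , p , q) = inj₂ (e , cong (x ∷_) p , q)

  ++-cancel-equalLength : ∀ (xs ys us vs : List A) → length xs ≡ length us →
                          xs ++ ys ≡ us ++ vs → xs ≡ us × ys ≡ vs
  ++-cancel-equalLength []       ys []       vs _   eq = refl , eq
  ++-cancel-equalLength (x ∷ xs) ys (u ∷ us) vs len eq with ∷-injective eq
  ... | refl , eq′ with ++-cancel-equalLength xs ys us vs (cong pred len) eq′
  ...   | refl , q = refl , q

  ++-assoc₃ : ∀ (xs ys zs ws : List A) → (xs ++ ys ++ zs) ++ ws ≡ xs ++ ys ++ zs ++ ws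
  ++-assoc₃ xs ys zs ws = trans (++-assoc xs (ys ++ zs) ws) (cong (xs ++_) (++-assoc ys zs ws))

  uncons-++ : ∀ {x : A} {xs ys zs ws} → length (x ∷ xs) ≤ length ys → ys ++ zs ≡ x ∷ ws →
              ∃ λ ys′ → ys ≡ x ∷ ys′ × ys′ ++ zs ≡ ws
  uncons-++ {ys = y ∷ ys′} _ eq with ∷-injective eq
  ... | refl , eq′ = ys′ , refl , eq′

  ++-commute-shift : ∀ (p t v : List A) → t ++ p ++ t ≡ p ++ t ++ v → v ≡ t × t ++ p ≡ p ++ t
  ++-commute-shift p t v eq
    with tp≡pt , refl ← ++-cancel-equalLength (t ++ p) t (p ++ t) v (length-++-comm t p)
                          (trans (++-assoc t p t) (trans eq (sym (++-assoc p t v))))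
    = refl , tp≡pt

  -- If R = u · e, the hypotheses force v = t and make t commute with e · u; otherwise
  -- u = R · e and the same hypotheses hold for the shorter e.
  ++-pump : ∀ (R S u t v : List A) →
            u ++ S ≡ R ++ u ++ t → u ++ t ++ S ≡ R ++ u ++ t ++ v →
            u ++ t ++ v ++ S ≡ R ++ u ++ t ++ v ++ t
  ++-pump R S u t _ = go R S u (<-wellFounded (length u))
    where
    go : ∀ R S u {v} → Acc _<_ (length u) →
         u ++ S ≡ R ++ u ++ t → u ++ t ++ S ≡ R ++ u ++ t ++ v →
         u ++ t ++ v ++ S ≡ R ++ u ++ t ++ v ++ t
    go R S u {v} (acc smaller) eq eq′ with ++-split u S R (u ++ t) eq
    ... | inj₁ (e , refl , refl)
      with refl , commutes ← ++-commute-shift (e ++ u) t v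
             (trans (cong (t ++_) (++-assoc e u t))
               (trans (++-cancelˡ u _ _ (trans eq′ (++-assoc u e _)))
                 (sym (++-assoc e u (t ++ v)))))
      = begin
        u ++ t ++ t ++ e ++ u ++ t   ≡⟨ cong (u ++_) (cong (t ++_) (shift t)) ⟩
        u ++ t ++ e ++ u ++ t ++ t   ≡⟨ cong (u ++_) (shift (t ++ t)) ⟩
        u ++ e ++ u ++ t ++ t ++ t   ≡⟨ ++-assoc u e _ ⟨
        (u ++ e) ++ u ++ t ++ t ++ t ∎
      where
      open ≡-Reasoning
      shift : ∀ ws → t ++ e ++ u ++ ws ≡ e ++ u ++ t ++ ws
      shift ws = begin
        t ++ e ++ u ++ ws     ≡⟨ ++-assoc₃ t e u ws ⟨
        (t ++ e ++ u) ++ ws   ≡⟨ cong (_++ ws) (trans commutes (++-assoc e u t)) ⟩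
        (e ++ u ++ t) ++ ws   ≡⟨ ++-assoc₃ e u t ws ⟩
        e ++ u ++ t ++ ws     ∎
    ... | inj₂ (e , refl , eq″) with R
    ...   | [] with refl ← ++-cancelˡ e t S eq″
                  | refl ← ++-cancelˡ t S v (++-cancelˡ e _ _ eq′) = refl
    ...   | R@(_ ∷ R′) = begin
        (R ++ e) ++ t ++ v ++ S      ≡⟨ ++-assoc R e _ ⟩
        R ++ e ++ t ++ v ++ S        ≡⟨ cong (R ++_) (go R S e (smaller shorter) eqₑ eqₑ′) ⟩
        R ++ R ++ e ++ t ++ v ++ t   ≡⟨ cong (R ++_) (++-assoc R e _) ⟨
        R ++ (R ++ e) ++ t ++ v ++ t ∎
      where
      open ≡-Reasoning
      shorter : length e < length (R ++ e)
      shorter = s≤s (length-++-≤ʳ e {R′})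
      eqₑ : e ++ S ≡ R ++ e ++ t
      eqₑ = trans (sym eq″) (++-assoc R e t)
      eqₑ′ : e ++ t ++ S ≡ R ++ e ++ t ++ v
      eqₑ′ = ++-cancelˡ R _ _
        (trans (sym (++-assoc R e _)) (trans eq′ (cong (R ++_) (++-assoc R e _))))

  prefix-pump : ∀ {R S u u′ u″ : List A} → Prefix _≡_ u u′ → Prefix _≡_ u′ u″ →
                u ++ S ≡ R ++ u′ → u′ ++ S ≡ R ++ u″ → ∃ λ t → u″ ++ S ≡ R ++ u″ ++ t
  prefix-pump {R} {S} {u} u≼u′ u′≼u″ eq eq′ with Prefix-as-∣ˡ u≼u′ | Prefix-as-∣ˡ u′≼u″
  ... | t , refl | v , refl = t , (begin
    ((u ++ t) ++ v) ++ S   ≡⟨ trans (++-assoc (u ++ t) v S) (++-assoc u t (v ++ S)) ⟩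
    u ++ t ++ v ++ S       ≡⟨ ++-pump R S u t v eq eq″ ⟩
    R ++ u ++ t ++ v ++ t  ≡⟨ cong (R ++_) (trans (++-assoc (u ++ t) v t) (++-assoc u t (v ++ t))) ⟨
    R ++ ((u ++ t) ++ v) ++ t ∎)
    where
    open ≡-Reasoning
    eq″ : u ++ t ++ S ≡ R ++ u ++ t ++ v
    eq″ = trans (sym (++-assoc u t S)) (trans eq′ (cong (R ++_) (++-assoc u t v)))

lookup∘updateAt-pointwise :
  ∀ {A B : Set} {n} (P : Fin n → A → B → Set) {xs : Vec A n} {ys : Vec B n} i f g →
  P i (f (lookup xs i)) (g (lookup ys i)) → (∀ j → j ≢ i → P j (lookup xs j) (lookup ys j)) →
  ∀ j → P j (lookup (xs [ i ]%= f) j) (lookup (ys [ i ]%= g) j)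
lookup∘updateAt-pointwise P {xs} {ys} i f g at-i elsewhere j with j ≟ i
... | yes refl rewrite lookup∘updateAt j {f} xs | lookup∘updateAt j {g} ys = at-i
... | no j≢i rewrite lookup∘updateAt′ j i {f} j≢i xs | lookup∘updateAt′ j i {g} j≢i ys =
  elsewhere j j≢i

invariant⇒infinitePath :
  ∀ {X : Set} (_↝_ : X → X → Set) (P : X → Set) → (∀ {x} → P x → Σ X λ y → x ↝ y × P y) →
  ∀ {x} → P x → Σ (ℕ → X) λ f → f 0 ≡ x × (∀ i → f i ↝ f (suc i))
invariant⇒infinitePath {X} _↝_ P progress {x} px =
  proj₁ ∘ walk , refl , proj₁ ∘ proj₂ ∘ progress ∘ proj₂ ∘ walk
  where
  walk : ℕ → Σ X P
  walk zero    = x , px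
  walk (suc i) = map₂ proj₂ (progress (proj₂ (walk i)))

module _ {nQ nC nA : ℕ} (M : FIFO nQ nC nA) where
  open OLTS M

  Word : Set
  Word = List (Fin nA)

  sent received : Fin nC → List Act → Word
  sent c [] = []
  sent c ((c′ , `! , a) ∷ σ) with c ≟ c′
  ... | yes _ = a ∷ sent c σ
  ... | no _  = sent c σ
  sent c ((_ , `? , _) ∷ σ) = sent c σ

  received c [] = []
  received c ((_ , `! , _) ∷ σ) = received c σ
  received c ((c′ , `? , a) ∷ σ) with c ≟ c′
  ... | yes _ = a ∷ received c σ
  ... | no _  = received c σ

  sent-here : ∀ c a σ → sent c ((c , `! , a) ∷ σ) ≡ a ∷ sent c σ
  sent-here c a σ with c ≟ c
  ... | yes _   = refl
  ... | no c≢c = ⊥-elim (c≢c refl)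

  received-here : ∀ c a σ → received c ((c , `? , a) ∷ σ) ≡ a ∷ received c σ
  received-here c a σ with c ≟ c
  ... | yes _   = refl
  ... | no c≢c = ⊥-elim (c≢c refl)

  sent-elsewhere : ∀ {c} α σ → c ≢ proj₁ α → sent c (α ∷ σ) ≡ sent c σ
  sent-elsewhere {c} (c′ , `! , a) σ c≢c′ with c ≟ c′
  ... | yes c≡c′ = ⊥-elim (c≢c′ c≡c′)
  ... | no _     = refl
  sent-elsewhere (_ , `? , _) σ _ = refl

  received-elsewhere : ∀ {c} α σ → c ≢ proj₁ α → received c (α ∷ σ) ≡ received c σ
  received-elsewhere (_ , `! , _) σ _ = refl
  received-elsewhere {c} (c′ , `? , a) σ c≢c′ with c ≟ c′
  ... | yes c≡c′ = ⊥-elim (c≢c′ c≡c′)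
  ... | no _     = refl

  ⟶*-channel : ∀ {q q′ w w′ σ} → (q , w) ⟶*[ σ ] (q′ , w′) →
               ∀ c → lookup w c ++ sent c σ ≡ received c σ ++ lookup w′ c
  ⟶*-channel {w = w} done c = ++-identityʳ (lookup w c)
  ⟶*-channel (step (send {c = c′} {a} {w} _) rest) c with c ≟ c′
  ... | yes refl = trans (sym (++-assoc (lookup w c) [ a ] _))
                         (trans (cong (_++ _) (sym (lookup∘updateAt c w))) (⟶*-channel rest c))
  ... | no c≢c′  = trans (cong (_++ _) (sym (lookup∘updateAt′ c c′ c≢c′ w))) (⟶*-channel rest c)
  ⟶*-channel (step (recv {c = c′} {a} {w} _ w[c′]≡a∷u) rest) c with c ≟ c′
  ... | yes refl rewrite w[c′]≡a∷u =
        cong (a ∷_) (trans (cong (_++ _) (sym (lookup∘updateAt c w))) (⟶*-channel rest c))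
  ... | no c≢c′  = trans (cong (_++ _) (sym (lookup∘updateAt′ c c′ c≢c′ w))) (⟶*-channel rest c)

  -- v can stand in for u while σ is replayed: the length bound keeps v nonempty at every
  -- receive from c, and the second field makes its heads the messages received.
  record Covers (σ : List Act) (c : Fin nC) (u v : Word) : Set where
    constructor covering
    field
      length-≤  : length u ≤ length v
      receives : ∃ λ e → v ++ sent c σ ≡ received c σ ++ e

  Covers-elsewhere : ∀ {α σ c u v} → c ≢ proj₁ α → Covers (α ∷ σ) c u v → Covers σ c u v
  Covers-elsewhere {α} {σ} {v = v} c≢ (covering len (e , eq)) =
    covering len
      (e , subst₂ (λ s r → v ++ s ≡ r ++ e) (sent-elsewhere α σ c≢) (received-elsewhere α σ c≢) eq)

  ⟶*-lift : ∀ {q q′ w w′ σ} → (q , w) ⟶*[ σ ] (q′ , w′) →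
            ∀ z → (∀ c → Covers σ c (lookup w c) (lookup z c)) → ∃ λ z′ → (q , z) ⟶*[ σ ] (q′ , z′)
  ⟶*-lift done z _ = z , done
  ⟶*-lift {σ = _ ∷ σ} (step (send {c = c′} {a} {w} m) rest) z covers =
    map₂ (step (send m))
      (⟶*-lift rest (z [ c′ ]%= (_++ [ a ]))
        (lookup∘updateAt-pointwise (Covers σ) {w} {z} c′ (_++ [ a ]) (_++ [ a ]) at-c′
          (λ c c≢c′ → Covers-elsewhere c≢c′ (covers c))))
    where
    at-c′ : Covers σ c′ (lookup w c′ ++ [ a ]) (lookup z c′ ++ [ a ])
    at-c′ with covering len (e , eq) ← covers c′ =
      covering
        (subst₂ _≤_ (sym (length-++ (lookup w c′))) (sym (length-++ (lookup z c′))) (+-monoˡ-≤ 1 len))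
        (e , trans (++-assoc (lookup z c′) [ a ] _)
               (trans (cong (lookup z c′ ++_) (sym (sent-here c′ a σ))) eq))
  ⟶*-lift {σ = _ ∷ σ} (step (recv {c = c′} {a} {w} {u} m w[c′]≡a∷u) rest) z covers
    with covering len (e , eq) ← covers c′
    with z₁ , z[c′]≡a∷z₁ , eq₁ ← uncons-++ {xs = u} (subst (λ l → length l ≤ _) w[c′]≡a∷u len)
                                            (trans eq (cong (_++ e) (received-here c′ a σ))) =
    map₂ (step (recv m z[c′]≡a∷z₁))
      (⟶*-lift rest (z [ c′ ]≔ z₁)
        (lookup∘updateAt-pointwise (Covers σ) {w} {z} c′ (λ _ → u) (λ _ → z₁) at-c′
          (λ c c≢c′ → Covers-elsewhere c≢c′ (covers c))))
    where
    at-c′ : Covers σ c′ u z₁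
    at-c′ =
      covering (s≤s⁻¹ (subst₂ (λ l l′ → length l ≤ length l′) w[c′]≡a∷u z[c′]≡a∷z₁ len)) (e , eq₁)

  ⟶*-pump : ∀ {x y z σ} → x ⟶*[ σ ] y → y ⟶*[ σ ] z → x ⪯p y → y ⪯p z →
            ∃ λ z′ → z ⟶*[ σ ] z′ × z ⪯p z′
  ⟶*-pump {_ , wx} {q , wy} {_ , wz} {σ} x⟶y y⟶z (refl , wx≼wy) (refl , wy≼wz) =
    (q , z′) , z⟶z′ , refl , wz≼z′
    where
    gap : ∀ c → ∃ λ t → lookup wz c ++ sent c σ ≡ received c σ ++ lookup wz c ++ t
    gap c = prefix-pump (wx≼wy c) (wy≼wz c) (⟶*-channel x⟶y c) (⟶*-channel y⟶z c)

    lifted : ∃ λ z′ → (q , wz) ⟶*[ σ ] (q , z′)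
    lifted = ⟶*-lift y⟶z wz λ c →
      covering (length-mono (wy≼wz c)) (lookup wz c ++ proj₁ (gap c) , proj₂ (gap c))

    z′ : Vec Word nC
    z′ = proj₁ lifted

    z⟶z′ : (q , wz) ⟶*[ σ ] (q , z′)
    z⟶z′ = proj₂ lifted

    wz≼z′ : ∀ c → Prefix _≡_ (lookup wz c) (lookup z′ c)
    wz≼z′ c = ∣ˡ-as-Prefix (proj₁ (gap c) ,
      ++-cancelˡ (received c σ) _ _ (trans (sym (proj₂ (gap c))) (⟶*-channel z⟶z′ c)))

  record Pumping (σ : List Act) : Set where
    field
      x y z : X
      x⟶y  : x ⟶*[ σ ] y
      y⟶z  : y ⟶*[ σ ] z
      x⪯y  : x ⪯p y
      y⪯z  : y ⪯p z

    next : Pumping σ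
    next = record
      { x⟶y = y⟶z ; y⟶z = proj₁ (proj₂ extension) ; x⪯y = y⪯z ; y⪯z = proj₂ (proj₂ extension) }
      where
      extension : ∃ λ z′ → z ⟶*[ σ ] z′ × z ⪯p z′
      extension = ⟶*-pump x⟶y y⟶z x⪯y y⪯z

  ReachablePumping : Set
  ReachablePumping =
    Σ Act λ α → Σ (List Act) λ σ → Σ (Pumping (α ∷ σ)) λ p →
      Σ (List Act) λ τ → x₀ ⟶*[ τ ] Pumping.x p

  reachablePumping⇒nonTerminating : ReachablePumping → NonTerminating
  reachablePumping⇒nonTerminating (α , σ , p , _ , x₀⟶x) =
    invariant⇒infinitePath _⟶_ ReachesPumping advance (p , _ , x₀⟶x)
    where
    ReachesPumping : X → Set
    ReachesPumping x = Σ (Pumping (α ∷ σ)) λ p → Σ (List Act) λ τ → x ⟶*[ τ ] Pumping.x p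

    advance : ∀ {x} → ReachesPumping x → Σ X λ y → x ⟶ y × ReachesPumping y
    advance (p , [] , done) with Pumping.x⟶y p
    ... | step e rest = _ , (α , e) , Pumping.next p , σ , rest
    advance (p , β ∷ τ , step e rest) = _ , (β , e) , p , τ , rest

  ⪯p-refl : ∀ x → x ⪯p x
  ⪯p-refl _ = refl , λ _ → fromPointwise (Pointwise.refl refl)

  ⟶*[]⇒≡ : ∀ {x y} → x ⟶*[ [] ] y → x ≡ y
  ⟶*[]⇒≡ done = refl

  module _ (v : RRTVertex) where
    open RRTVertex v

    path : ∀ {i k} → i ≤‴ k → k ≤ depth → Σ (List Act) λ τ → label i ⟶*[ τ ] label k
    path ≤‴-refl _ = [] , done
    path {i} (≤‴-step i<‴k) k≤depth =
      let α , e = edges i (≤-trans (≤‴⇒≤ i<‴k) k≤depth)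
          τ , r = path i<‴k k≤depth
      in α ∷ τ , step e r

    root-path : ∀ {k} → k ≤ depth → Σ (List Act) λ τ → x₀ ⟶*[ τ ] label k
    root-path {k} k≤depth = map₂ (subst (_⟶*[ _ ] label k) root) (path (≤⇒≤‴ z≤n) k≤depth)

  iterable⇒reachablePumping : HasIterableNode → ReachablePumping
  -- An empty σ makes the subsuming ancestor carry the same label, so the nonempty
  -- tree path between them is a cycle.
  iterable⇒reachablePumping (v , j , j<depth , _ , [] , x⟶x′ , _) =
    _ , _ , record { x⟶y = cycle ; y⟶z = cycle ; x⪯y = ⪯p-refl x′ ; y⪯z = ⪯p-refl x′ } ,
    root-path v ≤-refl
    where
    open RRTVertex v
    x′ : X
    x′ = label depth
    ancestor-path : Σ (List Act) λ τ → label j ⟶*[ τ ] x′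
    ancestor-path = path v (≤‴-step (≤⇒≤‴ j<depth)) ≤-refl
    cycle : x′ ⟶*[ proj₁ ancestor-path ] x′
    cycle = subst (_⟶*[ proj₁ ancestor-path ] x′) (⟶*[]⇒≡ x⟶x′) (proj₂ ancestor-path)
  iterable⇒reachablePumping (v , j , j<depth , x⪯x′ , α ∷ σ , x⟶x′ , _ , x′⟶x″ , x′⪯x″) =
    α , σ , record { x⟶y = x⟶x′ ; y⟶z = x′⟶x″ ; x⪯y = x⪯x′ ; y⪯z = x′⪯x″ } ,
    root-path v (<⇒≤ j<depth)

proposition4p12 : ∀ {nQ nC nA : ℕ} (M : FIFO nQ nC nA) →
    OLTS.HasIterableNode M → OLTS.NonTerminating M
proposition4p12 M = reachablePumping⇒nonTerminating M ∘ iterable⇒reachablePumping M
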